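{- Let agents $N=[n]$ have matroid rank valuations over a finite set of goods $G$ and let $\pi$ be a priority order. At the beginning of every iteration of the Yankee Swap algorithm, the current allocation $X$ is non-redundant for the set of agents $N\cup\{0\}$.
   Context: A valuation $v:2^G\to\mathbb{R}_{\ge 0}$ is a matroid rank valuation if $v(\emptyset)=0$, $v(S\cup\{g\})-v(S)\in\{0,1\}$ for all $S,g$, and $v$ is submodular. An allocation is a partition $X=(X_0,\dots,X_n)$ of $G$; $X_0$ (unallocated goods) is held by a dummy agent $0$ with $v_0(S)=|S|$. $X$ is non-redundant if $v_i(X_i)=|X_i|$ for all $i\in N\cup\{0\}$. A transfer path from $i$ to $j$ in $X$ is a sequence of distinct goods $(g_1,\dots,g_k)$, $g_k\in X_j$, such that moving $g_k$ to the owner of $g_{k-1}$, ..., $g_2$ to the owner of $g_1$, and $g_1$ to $i$ increases $v_i$ by $1$, decreases $v_j$ by $1$, and leaves all other agents' values unchanged. Yankee Swap with priority order $\pi:N\to[n]$: start with $X_0=G$, $X_i=\emptyset$, $P=N$; while $P\ne\emptyset$, let $i$ be the highest-priority (smallest $\pi$) agent among those in $P$ with minimum $|X_i|$; if a transfer path from $i$ to $0$ exists, execute it, else remove $i$ from $P$. -}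

module Defs where

open import Data.Nat using (ℕ; zero; suc; _+_; _≤_)
open import Data.Fin using (Fin; toℕ) renaming (zero to fzero; suc to fsuc)
open import Data.Fin.Properties using (_≟_)
open import Data.Fin.Subset using (Subset; _∪_; _∩_; ⁅_⁆; ∣_∣; _∈_; _-_) renaming (⊥ to ∅; ⊤ to full)
open import Data.Fin.Permutation using (Permutation′; _⟨$⟩ʳ_)
open import Data.Vec using (tabulate)
open import Data.Bool using (if_then_else_)
open import Data.List using (List; []; _∷_; _∷ʳ_)
open import Data.List.Relation.Unary.Unique.Propositional using (Unique)
open import Data.Product using (_×_; _,_; ∃; ∃₂; Σ)
open import Data.Sum using (_⊎_)
open import Relation.Nullary using (¬_; does)
open import Relation.Binary.PropositionalEquality using (_≡_; _≢_)
open import Relation.Binary.Construct.Closure.ReflexiveTransitive using (Star)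

-- A valuation on subsets of the goods Fin m (values are naturals: for a
-- matroid rank function all values are automatically integers).
Valuation : ℕ → Set
Valuation m = Subset m → ℕ

IsMatroidRank : ∀ {m} → Valuation m → Set
IsMatroidRank {m} v =
  (v ∅ ≡ 0)
  × (∀ (S : Subset m) (g : Fin m) → (v (S ∪ ⁅ g ⁆) ≡ v S) ⊎ (v (S ∪ ⁅ g ⁆) ≡ suc (v S)))
  × (∀ (S T : Subset m) → v (S ∪ T) + v (S ∩ T) ≤ v S + v T)

-- An allocation of goods Fin m to agents {0,1,...,n}, encoded as an owner
-- function; agent fzero is the dummy agent 0, agent (fsuc i) is agent i ∈ N.
Allocation : ℕ → ℕ → Set
Allocation n m = Fin m → Fin (suc n)

bundle : ∀ {n m} → Allocation n m → Fin (suc n) → Subset m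
bundle X a = tabulate (λ g → does (X g ≟ a))

allVals : ∀ {n m} → (Fin n → Valuation m) → Fin (suc n) → Valuation m
allVals v fzero = ∣_∣
allVals v (fsuc i) = v i

NonRedundant : ∀ {n m} → (Fin n → Valuation m) → Allocation n m → Set
NonRedundant v X = ∀ a → allVals v a (bundle X a) ≡ ∣ bundle X a ∣

-- Executing the moves along a sequence of goods (g₁,…,g_k): g₁ goes to the
-- recipient r, and g_{t+1} goes to the (original) owner of g_t.
moveAlong : ∀ {n m} → Allocation n m → Fin (suc n) → List (Fin m) → Allocation n m
moveAlong X r [] g' = X g'
moveAlong X r (g ∷ gs) g' = if does (g' ≟ g) then r else moveAlong X (X g) gs g'

TransferPath : ∀ {n m} → (Fin n → Valuation m) → Allocation n m
             → Fin (suc n) → Fin (suc n) → List (Fin m) → Set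
TransferPath v X a b gs =
  Unique gs
  × (∃₂ λ hs gk → (gs ≡ hs ∷ʳ gk) × (X gk ≡ b))
  × (allVals v a (bundle Y a) ≡ suc (allVals v a (bundle X a)))
  × (suc (allVals v b (bundle Y b)) ≡ allVals v b (bundle X b))
  × (∀ c → c ≢ a → c ≢ b → allVals v c (bundle Y c) ≡ allVals v c (bundle X c))
  where Y = moveAlong X a gs

record YSState (n m : ℕ) : Set where
  constructor ⟨_,_⟩
  field
    alloc : Allocation n m
    active : Subset n

Selected : ∀ {n m} → Permutation′ n → YSState n m → Fin n → Set
Selected π ⟨ X , P ⟩ i =
  (i ∈ P)
  × (∀ k → k ∈ P → ∣ bundle X (fsuc i) ∣ ≤ ∣ bundle X (fsuc k) ∣)
  × (∀ k → k ∈ P → ∣ bundle X (fsuc k) ∣ ≡ ∣ bundle X (fsuc i) ∣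
       → toℕ (π ⟨$⟩ʳ i) ≤ toℕ (π ⟨$⟩ʳ k))

-- One iteration of Yankee Swap (any transfer path may be executed).
data YSStep {n m} (v : Fin n → Valuation m) (π : Permutation′ n)
     : YSState n m → YSState n m → Set where
  transfer : ∀ {X P i gs} → Selected π ⟨ X , P ⟩ i
           → TransferPath v X (fsuc i) fzero gs
           → YSStep v π ⟨ X , P ⟩ ⟨ moveAlong X (fsuc i) gs , P ⟩
  remove   : ∀ {X P i} → Selected π ⟨ X , P ⟩ i
           → ¬ (Σ (List (Fin m)) λ gs → TransferPath v X (fsuc i) fzero gs)
           → YSStep v π ⟨ X , P ⟩ ⟨ X , P - i ⟩

initState : ∀ {n m} → YSState n m
initState = ⟨ (λ _ → fzero) , full ⟩

-- States reached at the beginning of some iteration (including the state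
-- after the last iteration, whose allocation coincides with an earlier one).
Reachable : ∀ {n m} → (Fin n → Valuation m) → Permutation′ n → YSState n m → Set
Reachable v π s = Star (YSStep v π) initState s

{-# OPTIONS --safe #-}
-- A rank function gains at most one per added good, so every agent values its
-- bundle at most at its size, and the dummy agent exactly at its size. If X is
-- non-redundant, its total value is the total size m of all bundles. A transfer
-- path raises one agent's value by one and lowers the dummy's by one, so after it
-- the total value is still m, the total size of the new bundles; with the
-- pointwise bound this forces v_a(X_a) = |X_a| for every agent a again.

module Submission where

open import Defs
open import Data.Nat using (ℕ; zero; suc; _+_; _≤_; z≤n; s≤s)
open import Data.Nat.Properties
  using (+-0-commutativeMonoid; +-comm; +-identityʳ; +-cancelʳ-≡; +-cancelʳ-≤; +-mono-≤;
         +-monoʳ-≤; ≤-refl; ≤-reflexive; ≤-antisym; n≤1+n; module ≤-Reasoning)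
open import Algebra.Properties.CommutativeMonoid.Sum +-0-commutativeMonoid
  using (sum; sum-syntax; sum-cong-≗; sum-replicate-zero; ∑-distrib-+; ∑-comm; sum-remove)
open import Data.Bool using (Bool; true; false)
open import Data.Bool.Properties using (∨-identityʳ)
open import Data.Empty using (⊥-elim)
open import Data.Fin using (Fin; punchIn) renaming (zero to fzero; suc to fsuc)
open import Data.Fin.Properties using (_≟_)
open import Data.Fin.Permutation using (Permutation′)
open import Data.Fin.Subset using (Subset; _∪_; ⁅_⁆; ∣_∣; _∈_; _-_; _⊂_) renaming (⊥ to ∅)
open import Data.Fin.Subset.Induction using (⊂-wellFounded)
open import Data.Fin.Subset.Properties
  using (nonempty?; Empty-unique; ∣⊥∣≡0; p─⊥≡p; ∪-identityʳ; x∈p⇒p-x⊂p; x∈p⇒∣p-x∣<∣p∣)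
open import Data.Product using (_,_; proj₁; proj₂)
open import Data.Sum using (inj₁; inj₂)
open import Data.Vec using (_∷_; tabulate; here; there)
open import Function using (_∘_)
open import Induction.WellFounded using (module All)
open import Relation.Binary.Construct.Closure.ReflexiveTransitive using (Star; ε; _◅_)
open import Relation.Binary.PropositionalEquality
open import Relation.Nullary using (does; yes; no)

p-x∪⁅x⁆≡p : ∀ {m} {x : Fin m} {p : Subset m} → x ∈ p → (p - x) ∪ ⁅ x ⁆ ≡ p
p-x∪⁅x⁆≡p {p = _ ∷ p} here = cong (true ∷_) (trans (cong (_∪ ∅) (p─⊥≡p p)) (∪-identityʳ p))
p-x∪⁅x⁆≡p {p = b ∷ _} (there x∈p) = cong₂ _∷_ (∨-identityʳ b) (p-x∪⁅x⁆≡p x∈p)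

tabulate-false≡∅ : ∀ m → tabulate {n = m} (λ _ → false) ≡ ∅
tabulate-false≡∅ zero = refl
tabulate-false≡∅ (suc m) = cong (false ∷_) (tabulate-false≡∅ m)

module _ {m} {v : Valuation m} (isRank : IsMatroidRank v) where

  private
    v∅≡0 = proj₁ isRank
    marginal = proj₁ (proj₂ isRank)

  rank-∪⁅g⁆≤1+rank : ∀ S g → v (S ∪ ⁅ g ⁆) ≤ suc (v S)
  rank-∪⁅g⁆≤1+rank S g with marginal S g
  ... | inj₁ same = subst (_≤ suc (v S)) (sym same) (n≤1+n (v S))
  ... | inj₂ up   = ≤-reflexive up

  rank≤card : ∀ S → v S ≤ ∣ S ∣
  rank≤card = All.wfRec ⊂-wellFounded _ (λ S → v S ≤ ∣ S ∣) step
    where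
    open ≤-Reasoning
    step : ∀ S → (∀ {T} → T ⊂ S → v T ≤ ∣ T ∣) → v S ≤ ∣ S ∣
    step S ih with nonempty? S
    ... | no S-empty rewrite Empty-unique S-empty = subst (_≤ ∣ ∅ {m} ∣) (sym v∅≡0) z≤n
    ... | yes (x , x∈S) = begin
      v S                  ≡⟨ cong v (p-x∪⁅x⁆≡p x∈S) ⟨
      v ((S - x) ∪ ⁅ x ⁆)  ≤⟨ rank-∪⁅g⁆≤1+rank (S - x) x ⟩
      suc (v (S - x))      ≤⟨ s≤s (ih (x∈p⇒p-x⊂p x∈S)) ⟩
      suc ∣ S - x ∣        ≤⟨ x∈p⇒∣p-x∣<∣p∣ x∈S ⟩
      ∣ S ∣                ∎

indicator : Bool → ℕ
indicator true  = 1
indicator false = 0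

∑-indicator-≟≡1 : ∀ {k} (y : Fin k) → ∑[ a < k ] indicator (does (y ≟ a)) ≡ 1
∑-indicator-≟≡1 {suc k} fzero    = cong suc (sum-replicate-zero k)
∑-indicator-≟≡1 {suc k} (fsuc y) = ∑-indicator-≟≡1 y

∑-one : ∀ k → ∑[ a < k ] 1 ≡ k
∑-one zero    = refl
∑-one (suc k) = cong suc (∑-one k)

∣tabulate∣≡∑ : ∀ {m} (f : Fin m → Bool) → ∣ tabulate f ∣ ≡ ∑[ g < m ] indicator (f g)
∣tabulate∣≡∑ {zero}  f = refl
∣tabulate∣≡∑ {suc m} f with f fzero
... | true  = cong suc (∣tabulate∣≡∑ (λ g → f (fsuc g)))
... | false = ∣tabulate∣≡∑ (λ g → f (fsuc g))

∑-mono-≤ : ∀ {k} {f g : Fin k → ℕ} → (∀ c → f c ≤ g c) → sum f ≤ sum g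
∑-mono-≤ {zero}  f≤g = z≤n
∑-mono-≤ {suc k} f≤g = +-mono-≤ (f≤g fzero) (∑-mono-≤ (λ c → f≤g (fsuc c)))

∑-≡-≤⇒≗ : ∀ {k} {f g : Fin k → ℕ} → (∀ c → f c ≤ g c) → sum f ≡ sum g → ∀ c → f c ≡ g c
∑-≡-≤⇒≗ {suc k} {f} {g} f≤g ∑f≡∑g c = ≤-antisym (f≤g c) (+-cancelʳ-≤ (sum f′) (g c) (f c) gc+∑f′≤fc+∑f′)
  where
  open ≤-Reasoning
  f′ g′ : Fin k → ℕ
  f′ j = f (punchIn c j)
  g′ j = g (punchIn c j)
  gc+∑f′≤fc+∑f′ : g c + sum f′ ≤ f c + sum f′
  gc+∑f′≤fc+∑f′ = begin
    g c + sum f′  ≤⟨ +-monoʳ-≤ (g c) (∑-mono-≤ (λ j → f≤g (punchIn c j))) ⟩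
    g c + sum g′  ≡⟨ sum-remove g ⟨
    sum g         ≡⟨ ∑f≡∑g ⟨
    sum f         ≡⟨ sum-remove f ⟩
    f c + sum f′  ∎

∑-transfer : ∀ {k} (f g : Fin k → ℕ) {a b} → a ≢ b → g a ≡ suc (f a) → suc (g b) ≡ f b
           → (∀ c → c ≢ a → c ≢ b → g c ≡ f c) → sum g ≡ sum f
∑-transfer {k} f g {a} {b} a≢b ga fb rest = +-cancelʳ-≡ 1 (sum g) (sum f) (begin
  sum g + 1                                    ≡⟨ cong (sum g +_) (∑-indicator-≟≡1 b) ⟨
  sum g + ∑[ c < k ] indicator (does (b ≟ c))  ≡⟨ ∑-distrib-+ g _ ⟨
  ∑[ c < k ] (g c + indicator (does (b ≟ c)))  ≡⟨ sum-cong-≗ pointwise ⟩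
  ∑[ c < k ] (f c + indicator (does (a ≟ c)))  ≡⟨ ∑-distrib-+ f _ ⟩
  sum f + ∑[ c < k ] indicator (does (a ≟ c))  ≡⟨ cong (sum f +_) (∑-indicator-≟≡1 a) ⟩
  sum f + 1                                    ∎)
  where
  open ≡-Reasoning
  pointwise : ∀ c → g c + indicator (does (b ≟ c)) ≡ f c + indicator (does (a ≟ c))
  pointwise c with a ≟ c | b ≟ c
  ... | yes refl | yes refl = ⊥-elim (a≢b refl)
  ... | yes refl | no _     = trans (+-identityʳ (g c)) (trans ga (+-comm 1 (f c)))
  ... | no _     | yes refl = trans (+-comm (g c) 1) (trans fb (sym (+-identityʳ (f c))))
  ... | no c≢a   | no c≢b   = cong (_+ 0) (rest c (c≢a ∘ sym) (c≢b ∘ sym))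

∑-∣bundle∣≡m : ∀ {n m} (X : Allocation n m) → ∑[ a < suc n ] ∣ bundle X a ∣ ≡ m
∑-∣bundle∣≡m {n} {m} X = begin
  ∑[ a < suc n ] ∣ bundle X a ∣                          ≡⟨ sum-cong-≗ (λ a → ∣tabulate∣≡∑ (λ g → does (X g ≟ a))) ⟩
  ∑[ a < suc n ] ∑[ g < m ] indicator (does (X g ≟ a))  ≡⟨ ∑-comm (λ a g → indicator (does (X g ≟ a))) ⟩
  ∑[ g < m ] ∑[ a < suc n ] indicator (does (X g ≟ a))  ≡⟨ sum-cong-≗ (λ g → ∑-indicator-≟≡1 (X g)) ⟩
  ∑[ g < m ] 1                                          ≡⟨ ∑-one m ⟩
  m                                                     ∎
  where open ≡-Reasoning

module _ {n m} {v : Fin n → Valuation m} (isRank : ∀ i → IsMatroidRank (v i)) where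

  allVals≤card : ∀ a S → allVals v a S ≤ ∣ S ∣
  allVals≤card fzero    S = ≤-refl
  allVals≤card (fsuc i) S = rank≤card (isRank i) S

  initState-nonRedundant : NonRedundant v (YSState.alloc (initState {n} {m}))
  initState-nonRedundant fzero = refl
  initState-nonRedundant (fsuc i) rewrite tabulate-false≡∅ m =
    trans (proj₁ (isRank i)) (sym (∣⊥∣≡0 m))

  transfer-preserves-nonRedundant : ∀ {X i gs} → NonRedundant v X → TransferPath v X (fsuc i) fzero gs
                                  → NonRedundant v (moveAlong X (fsuc i) gs)
  transfer-preserves-nonRedundant {X} {i} {gs} nonRedundantX (_ , _ , gain , loss , others) =
    ∑-≡-≤⇒≗ (λ a → allVals≤card a (bundle Y a)) (begin
      sum (value Y)                  ≡⟨ ∑-transfer (value X) (value Y) (λ ()) gain loss others ⟩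
      sum (value X)                  ≡⟨ sum-cong-≗ nonRedundantX ⟩
      ∑[ a < suc n ] ∣ bundle X a ∣  ≡⟨ ∑-∣bundle∣≡m X ⟩
      m                              ≡⟨ ∑-∣bundle∣≡m Y ⟨
      ∑[ a < suc n ] ∣ bundle Y a ∣  ∎)
    where
    open ≡-Reasoning
    Y = moveAlong X (fsuc i) gs
    value : Allocation n m → Fin (suc n) → ℕ
    value Z a = allVals v a (bundle Z a)

  step-preserves-nonRedundant : ∀ {π s t} → YSStep v π s t
                              → NonRedundant v (YSState.alloc s) → NonRedundant v (YSState.alloc t)
  step-preserves-nonRedundant (transfer _ path) nr = transfer-preserves-nonRedundant nr path
  step-preserves-nonRedundant (remove _ _)      nr = nr

  steps-preserve-nonRedundant : ∀ {π s t} → Star (YSStep v π) s t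
                              → NonRedundant v (YSState.alloc s) → NonRedundant v (YSState.alloc t)
  steps-preserve-nonRedundant ε            nr = nr
  steps-preserve-nonRedundant (step ◅ run) nr =
    steps-preserve-nonRedundant run (step-preserves-nonRedundant step nr)

lemma2 : (n m : ℕ) (v : Fin n → Valuation m) → (∀ i → IsMatroidRank (v i))
       → (π : Permutation′ n) (s : YSState n m) → Reachable v π s
       → NonRedundant v (YSState.alloc s)
lemma2 n m v isRank π s reachable =
  steps-preserve-nonRedundant isRank reachable (initState-nonRedundant isRank)
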